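{- Let $m$ be an integer. If $m$ is not represented by $x^2+y^2+3z^2$, then $9m$ is not represented by $x^2+y^2+3z^2$.
   Context: An integer $n$ is represented by a form $Q(x,y,z)$ if there exist integers $x,y,z$ with $Q(x,y,z)=n$. -}

module Defs where

open import Data.Integer using (ℤ; _+_; _*_; +_)
open import Data.Product using (∃-syntax)
open import Relation.Binary.PropositionalEquality using (_≡_)

Q : ℤ → ℤ → ℤ → ℤ
Q x y z = x * x + y * y + + 3 * (z * z)

RepresentedByQ : ℤ → Set
RepresentedByQ n = ∃[ x ] ∃[ y ] ∃[ z ] Q x y z ≡ n

{-# OPTIONS --safe #-}

-- Squares are 0 or 1 modulo 3, so x² + y² ≡ 0 (mod 3) forces 3 ∣ x and 3 ∣ y.
-- If x² + y² + 3z² = 9m, then writing x = 3a, y = 3b leaves 3z² = 9(m − a² − b²),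
-- so 3 ∣ z as well, and dividing by 9 gives m = a² + b² + 3c².
module Submission where

open import Defs
open import Data.Integer using (ℤ; _*_; +_; _+_; _-_)
open import Data.Integer.Properties using (*-cancelˡ-≡; +-comm)
open import Data.Integer.DivMod using (_%ℕ_; _/ℕ_; a≡a%ℕn+[a/ℕn]*n; n%ℕd<d)
open import Data.Integer.Divisibility.Signed
  using (_∣_; divides; ∣⇒∣ᵤ; ∣-refl; ∣m∣n⇒∣m-n; ∣m⇒∣m*n; ∣n⇒∣m*n)
open import Data.Integer.Tactic.RingSolver using (solve)
open import Data.Nat as ℕ using (NonZero; s≤s; z≤n)
open import Data.Nat.Divisibility using (>⇒∤)
open import Data.List using (_∷_; [])
open import Data.Product using (_,_; _×_)
open import Data.Sum using (_⊎_; inj₁; inj₂)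
open import Data.Empty using (⊥-elim)
open import Relation.Nullary using (¬_)
open import Relation.Binary.PropositionalEquality using (_≡_; refl; sym; trans; cong; subst; module ≡-Reasoning)
open ≡-Reasoning

+m∤+n : ∀ {m n} .{{_ : NonZero n}} → n ℕ.< m → ¬ (+ m ∣ + n)
+m∤+n n<m m∣n = >⇒∤ n<m (∣⇒∣ᵤ m∣n)

3∣i⊎3∣i*i-1 : ∀ i → + 3 ∣ i ⊎ + 3 ∣ i * i - + 1
3∣i⊎3∣i*i-1 i = byResidue (i %ℕ 3) (i /ℕ 3) (n%ℕd<d i 3) (a≡a%ℕn+[a/ℕn]*n i 3)
  where
  byResidue : ∀ r q → r ℕ.< 3 → i ≡ + r + q * + 3 → + 3 ∣ i ⊎ + 3 ∣ i * i - + 1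
  byResidue 0 q _ refl = inj₁ (divides q (solve (q ∷ [])))
  byResidue 1 q _ refl = inj₂ (divides (q * q * + 3 + + 2 * q) (solve (q ∷ [])))
  byResidue 2 q _ refl = inj₂ (divides (q * q * + 3 + + 4 * q + + 1) (solve (q ∷ [])))
  byResidue (ℕ.suc (ℕ.suc (ℕ.suc _))) _ (s≤s (s≤s (s≤s ()))) _

3∤1 : ¬ (+ 3 ∣ + 1)
3∤1 = +m∤+n (s≤s (s≤s z≤n))

3∤2 : ¬ (+ 3 ∣ + 2)
3∤2 = +m∤+n (s≤s (s≤s (s≤s z≤n)))

3∣i*i⇒3∣i : ∀ i → + 3 ∣ i * i → + 3 ∣ i
3∣i*i⇒3∣i i 3∣i*i with 3∣i⊎3∣i*i-1 i
... | inj₁ 3∣i     = 3∣i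
... | inj₂ 3∣i*i-1 = ⊥-elim (3∤1 (subst (+ 3 ∣_) i*i-[i*i-1]≡1 (∣m∣n⇒∣m-n 3∣i*i 3∣i*i-1)))
  where
  i*i-[i*i-1]≡1 : i * i - (i * i - + 1) ≡ + 1
  i*i-[i*i-1]≡1 = solve (i ∷ [])

3∣i*i+j*j⇒3∣i : ∀ i j → + 3 ∣ i * i + j * j → + 3 ∣ i
3∣i*i+j*j⇒3∣i i j 3∣sum with 3∣i⊎3∣i*i-1 i | 3∣i⊎3∣i*i-1 j
... | inj₁ 3∣i     | _            = 3∣i
... | inj₂ 3∣i*i-1 | inj₁ 3∣j     =
  ⊥-elim (3∤1 (subst (+ 3 ∣_) sum-j*j-[i*i-1]≡1 (∣m∣n⇒∣m-n (∣m∣n⇒∣m-n 3∣sum (∣n⇒∣m*n j 3∣j)) 3∣i*i-1)))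
  where
  sum-j*j-[i*i-1]≡1 : i * i + j * j - j * j - (i * i - + 1) ≡ + 1
  sum-j*j-[i*i-1]≡1 = solve (i ∷ j ∷ [])
... | inj₂ 3∣i*i-1 | inj₂ 3∣j*j-1 =
  ⊥-elim (3∤2 (subst (+ 3 ∣_) sum-[i*i-1]-[j*j-1]≡2 (∣m∣n⇒∣m-n (∣m∣n⇒∣m-n 3∣sum 3∣i*i-1) 3∣j*j-1)))
  where
  sum-[i*i-1]-[j*j-1]≡2 : i * i + j * j - (i * i - + 1) - (j * j - + 1) ≡ + 2
  sum-[i*i-1]-[j*j-1]≡2 = solve (i ∷ j ∷ [])

Q-homogeneous : ∀ x y z k → Q (x * k) (y * k) (z * k) ≡ k * k * Q x y z
Q-homogeneous x y z k = expanded
  where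
  expanded : x * k * (x * k) + y * k * (y * k) + + 3 * (z * k * (z * k)) ≡ k * k * (x * x + y * y + + 3 * (z * z))
  expanded = solve (x ∷ y ∷ z ∷ k ∷ [])

3∣Q⇒3∣x×3∣y : ∀ x y z → + 3 ∣ Q x y z → + 3 ∣ x × + 3 ∣ y
3∣Q⇒3∣x×3∣y x y z 3∣Q = 3∣i*i+j*j⇒3∣i x y 3∣x*x+y*y , 3∣i*i+j*j⇒3∣i y x (subst (+ 3 ∣_) (+-comm (x * x) (y * y)) 3∣x*x+y*y)
  where
  x*x+y*y+3z*z-z*z*3≡x*x+y*y : x * x + y * y + + 3 * (z * z) - z * z * + 3 ≡ x * x + y * y
  x*x+y*y+3z*z-z*z*3≡x*x+y*y = solve (x ∷ y ∷ z ∷ [])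

  3∣x*x+y*y : + 3 ∣ x * x + y * y
  3∣x*x+y*y = subst (+ 3 ∣_) x*x+y*y+3z*z-z*z*3≡x*x+y*y (∣m∣n⇒∣m-n 3∣Q (∣n⇒∣m*n (z * z) (divides (+ 1) refl)))

9∣Q[3a,3b,z]⇒3∣z : ∀ a b z → + 9 ∣ Q (a * + 3) (b * + 3) z → + 3 ∣ z
9∣Q[3a,3b,z]⇒3∣z a b z (divides q Q≡q*9) =
  3∣i*i⇒3∣i z (divides (q - a * a - b * b) (*-cancelˡ-≡ (+ 3) _ _ 3z²≡3[[q-a²-b²]*3]))
  where
  3z²≡Q-9a²-9b² : + 3 * (z * z) ≡ a * + 3 * (a * + 3) + b * + 3 * (b * + 3) + + 3 * (z * z) - + 9 * (a * a) - + 9 * (b * b)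
  3z²≡Q-9a²-9b² = solve (a ∷ b ∷ z ∷ [])

  9q-9a²-9b²≡3[[q-a²-b²]*3] : q * + 9 - + 9 * (a * a) - + 9 * (b * b) ≡ + 3 * ((q - a * a - b * b) * + 3)
  9q-9a²-9b²≡3[[q-a²-b²]*3] = solve (a ∷ b ∷ q ∷ [])

  3z²≡3[[q-a²-b²]*3] : + 3 * (z * z) ≡ + 3 * ((q - a * a - b * b) * + 3)
  3z²≡3[[q-a²-b²]*3] = begin
    + 3 * (z * z)                                           ≡⟨ 3z²≡Q-9a²-9b² ⟩
    Q (a * + 3) (b * + 3) z - + 9 * (a * a) - + 9 * (b * b) ≡⟨ cong (λ t → t - + 9 * (a * a) - + 9 * (b * b)) Q≡q*9 ⟩
    q * + 9 - + 9 * (a * a) - + 9 * (b * b)                 ≡⟨ 9q-9a²-9b²≡3[[q-a²-b²]*3] ⟩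
    + 3 * ((q - a * a - b * b) * + 3)                       ∎

mainTheorem7 : (m : ℤ) → ¬ RepresentedByQ m → ¬ RepresentedByQ (+ 9 * m)
mainTheorem7 m ¬rep (x , y , z , Q≡9m)
  with divides a refl , divides b refl ← 3∣Q⇒3∣x×3∣y x y z (subst (+ 3 ∣_) (sym Q≡9m) (∣m⇒∣m*n m (divides (+ 3) refl)))
  with divides c refl ← 9∣Q[3a,3b,z]⇒3∣z a b z (subst (+ 9 ∣_) (sym Q≡9m) (∣m⇒∣m*n m ∣-refl))
  = ¬rep (a , b , c , *-cancelˡ-≡ (+ 9) _ _ (trans (sym (Q-homogeneous a b c (+ 3))) Q≡9m))
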